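{- For $k\ge2$, let $a_1,\dots,a_k\ge1$ be natural numbers, and consider the complete multipartite graph $\mathsf K_{a_1,\dots,a_k}$. Then $$\iota(\mathsf K_{a_1,\dots,a_k})=\begin{cases}1+\left(\sum_{i=1}^k\frac{a_i}{a_i-2}\right)^{ -1}, & \text{if no } a_i=2,\\ 1, & \text{if some } a_i=2,\end{cases}$$ where $\iota(\mathsf K_{a_1,\dots,a_k})=\infty$ when $\sum_{i=1}^k\frac{a_i}{a_i-2}=0$. In particular, if $k\ge5$, then $\iota(\mathsf K_{1,1,k})=-\frac{2}{k-4}$.
   Context: All graphs are finite, simple, undirected. For a connected graph $G$ with vertices $v_1,\dots,v_n$, $D=(d(v_i,v_j))_{i,j}$ is its shortest-path distance matrix and $\vec 1$ the all-ones vector. A curvature potential is a vector $\vec x$ with $D\vec x=\vec 1$; $G$ is distance exceptional if it has no curvature potential. Let $X(G)=\{D\vec x:\vec x\in\mathbb{R}^n,\ \vec x^\top\vec 1=1\}$. If $G$ is distance exceptional or has a curvature potential $\vec x$ with $\vec 1^\top\vec x\ne 0$, then $X(G)\cap\mathbb{R}\vec 1$ is a single point, and the curvature index $\iota(G)\in\mathbb{R}$ is defined by $X(G)\cap\mathbb{R}\vec 1=\{\iota(G)\vec 1\}$; otherwise $\iota(G):=\infty$.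
   Formalization: Curvature potentials and the vectors defining X(G) have rational entries, and the multiples of $\vec 1$ in that intersection are taken over ℚ, in place of $\mathbb{R}^n$ and $\mathbb{R}\vec 1$. -}

module Defs where

open import Data.Nat as ℕ using (ℕ; zero; suc)
open import Data.Fin using (Fin; zero; suc)
open import Data.Product using (Σ; ∃; _×_; _,_)
open import Data.Sum using (_⊎_)
open import Relation.Nullary using (¬_; yes; no)
open import Relation.Binary.PropositionalEquality using (_≡_; _≢_)
open import Data.Rational as ℚ using (ℚ; 0ℚ; 1ℚ; _+_; _*_; _-_; 1/_; _≟_; ≢-nonZero)
open import Data.Integer using (+_)

∑ : ∀ {n} → (Fin n → ℚ) → ℚ
∑ {zero}  f = 0ℚ
∑ {suc n} f = f zero + ∑ (λ i → f (suc i))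

ℕ→ℚ : ℕ → ℚ
ℕ→ℚ n = (+ n) ℚ./ 1

-- total inverse: inv p = 1/p for p ≢ 0 (and 0 for p = 0; only used at p ≢ 0)
inv : ℚ → ℚ
inv p with p ≟ 0ℚ
... | yes _ = 0ℚ
... | no ne = 1/_ p {{≢-nonZero ne}}

-- The complete multipartite graph K_{a_1,...,a_k}
-- vertices: pairs (i , j) with i : Fin k the part, j : Fin (a i)

Vertex : ∀ {k} → (Fin k → ℕ) → Set
Vertex {k} a = Σ (Fin k) (λ i → Fin (a i))

Adj : ∀ {k} (a : Fin k → ℕ) → Vertex a → Vertex a → Set
Adj a (i , _) (i′ , _) = i ≢ i′

data Walk {k} (a : Fin k → ℕ) : Vertex a → Vertex a → ℕ → Set where
  nil  : ∀ {u} → Walk a u u 0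
  cons : ∀ {u w v m} → Adj a u w → Walk a w v m → Walk a u v (suc m)

-- d is the shortest-path distance of K_a (this also forces connectedness)
IsDistance : ∀ {k} (a : Fin k → ℕ) → (Vertex a → Vertex a → ℕ) → Set
IsDistance a d = ∀ u v → Walk a u v (d u v) × (∀ m → Walk a u v m → d u v ℕ.≤ m)

∑V : ∀ {k} (a : Fin k → ℕ) → (Vertex a → ℚ) → ℚ
∑V a f = ∑ (λ i → ∑ (λ j → f (i , j)))

_·_ : ∀ {k} {a : Fin k → ℕ} → (Vertex a → Vertex a → ℕ) → (Vertex a → ℚ) → Vertex a → ℚ
_·_ {a = a} D x u = ∑V a (λ v → ℕ→ℚ (D u v) * x v)

IsPotential : ∀ {k} (a : Fin k → ℕ) → (Vertex a → Vertex a → ℕ) → (Vertex a → ℚ) → Set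
IsPotential a D x = ∀ u → (D · x) u ≡ 1ℚ

DistanceExceptional : ∀ {k} (a : Fin k → ℕ) → (Vertex a → Vertex a → ℕ) → Set
DistanceExceptional a D = ¬ (∃ λ x → IsPotential a D x)

InX : ∀ {k} (a : Fin k → ℕ) → (Vertex a → Vertex a → ℕ) → (Vertex a → ℚ) → Set
InX a D y = ∃ λ x → ∑V a x ≡ 1ℚ × (∀ u → (D · x) u ≡ y u)

FiniteCase : ∀ {k} (a : Fin k → ℕ) → (Vertex a → Vertex a → ℕ) → Set
FiniteCase a D = DistanceExceptional a D ⊎ (∃ λ x → IsPotential a D x × ∑V a x ≢ 0ℚ)

data ℚ∞ : Set where
  fin : ℚ → ℚ∞
  ∞   : ℚ∞

CurvatureIndexIs : ∀ {k} (a : Fin k → ℕ) → (Vertex a → Vertex a → ℕ) → ℚ∞ → Set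
CurvatureIndexIs a D (fin t) =
  FiniteCase a D × InX a D (λ _ → t) × (∀ s → InX a D (λ _ → s) → s ≡ t)
CurvatureIndexIs a D ∞ = ¬ FiniteCase a D

-- ∑_i a_i / (a_i - 2)   (used only when no a_i = 2)
S : ∀ {k} → (Fin k → ℕ) → ℚ
S a = ∑ (λ i → ℕ→ℚ (a i) * inv (ℕ→ℚ (a i) - ℕ→ℚ 2))

a11 : ℕ → Fin 3 → ℕ
a11 m zero = 1
a11 m (suc zero) = 1
a11 m (suc (suc zero)) = m

{-# OPTIONS --safe #-}

-- In K_{a_1,...,a_k} two distinct vertices are at distance 1 or 2 according as they lie in
-- different parts or in the same part, so (D x)_(i,j) = T + P_i - 2 x_(i,j), where T is the
-- total mass of x and P_i its mass on part i. If D x = t 1, summing over part i gives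
-- (a_i - 2) P_i = a_i (t - T). When no a_i = 2 this determines every P_i, and summing over i
-- gives T = S (t - T) with S = Σ a_i / (a_i - 2): for T = 1 this is t = 1 + 1/S, and when
-- S = 0 every potential has total mass 0. When some a_i = 2 it forces t = T instead.
-- Conversely, vectors constant on each part, equal to u / (a_i - 2) on part i (or supported
-- on a part of size 2), realise these values.

module Submission where

open import Defs
open import Data.Nat as ℕ using (ℕ; _≤_; _≥_)
open import Data.Fin using (Fin)
open import Data.Product using (∃; _×_)
open import Relation.Binary.PropositionalEquality using (_≡_; _≢_)
open import Data.Rational as ℚ using (ℚ; 0ℚ; 1ℚ; _+_; _*_; _-_; -_)

open import Level using (0ℓ)
open import Function.Base using (_∘_; _∋_)
open import Data.Nat.Base using (zero; suc; _<_; z≤n; s≤s)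
import Data.Nat.Properties as ℕₚ
open import Data.Fin as Fin using (zero; suc; punchIn; fromℕ<)
open import Data.Fin.Properties using (punchInᵢ≢i; suc-injective)
import Data.Integer.Base as ℤ
import Data.Integer.Properties as ℤₚ
import Data.Nat.Coprimality as Coprimality
open import Data.Product.Base using (_,_; proj₁; proj₂)
open import Data.Sum.Base using (inj₁; inj₂)
open import Data.Vec.Functional using (updateAt)
open import Data.Vec.Functional.Properties using (updateAt-updates; updateAt-minimal)
open import Relation.Nullary using (¬_; yes; no; contradiction)
open import Relation.Nullary.Decidable.Core using (dec⇒maybe)
open import Relation.Binary.PropositionalEquality
  using (refl; sym; trans; cong; cong₂; subst; ≢-sym; module ≡-Reasoning)
open import Data.Rational.Base using (mkℚ; ½)
open import Data.Rational.Properties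
  using (+-*-commutativeRing; normalize-coprime; *-inverseʳ; +-assoc; +-identityˡ; *-assoc;
         *-zeroˡ; *-zeroʳ; *-identityˡ; *-identityʳ; *-distribˡ-+; *-distribʳ-+)
open import Tactic.RingSolver using (solve-∀)
open import Tactic.RingSolver.Core.AlmostCommutativeRing using (AlmostCommutativeRing; fromCommutativeRing)

open ≡-Reasoning

ℚ-ring : AlmostCommutativeRing 0ℓ 0ℓ
ℚ-ring = fromCommutativeRing +-*-commutativeRing (λ p → dec⇒maybe (0ℚ ℚ.≟ p))

ℕ→ℚ≡mkℚ : ∀ n → ℕ→ℚ n ≡ mkℚ (ℤ.+ n) 0 (Coprimality.sym (Coprimality.1-coprimeTo n))
ℕ→ℚ≡mkℚ n = normalize-coprime _

ℕ→ℚ-suc : ∀ n → ℕ→ℚ (suc n) ≡ 1ℚ + ℕ→ℚ n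
ℕ→ℚ-suc n = sym (begin
  1ℚ + ℕ→ℚ n                       ≡⟨ cong (1ℚ +_) (ℕ→ℚ≡mkℚ n) ⟩
  (ℤ.+ 1 ℤ.+ ℤ.+ n ℤ.* ℤ.+ 1) ℚ./ 1  ≡⟨ cong (λ z → (ℤ.+ 1 ℤ.+ z) ℚ./ 1) (ℤₚ.*-identityʳ (ℤ.+ n)) ⟩
  ℕ→ℚ (suc n)                      ∎)

ℕ→ℚ-injective : ∀ {m n} → ℕ→ℚ m ≡ ℕ→ℚ n → m ≡ n
ℕ→ℚ-injective {m} {n} eq =
  ℤₚ.+-injective (cong ℚ.numerator (trans (sym (ℕ→ℚ≡mkℚ m)) (trans eq (ℕ→ℚ≡mkℚ n))))

p-q≡0⇒p≡q : ∀ {p q} → p - q ≡ 0ℚ → p ≡ q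
p-q≡0⇒p≡q {p} {q} p-q≡0 = begin
  p            ≡⟨ rearrange p q ⟩
  (p - q) + q  ≡⟨ cong (_+ q) p-q≡0 ⟩
  0ℚ + q       ≡⟨ +-identityˡ q ⟩
  q            ∎
  where
  rearrange : ∀ p q → p ≡ (p - q) + q
  rearrange = solve-∀ ℚ-ring

ℕ→ℚ-difference≢0 : ∀ {m n} → m ≢ n → ℕ→ℚ m - ℕ→ℚ n ≢ 0ℚ
ℕ→ℚ-difference≢0 m≢n = m≢n ∘ ℕ→ℚ-injective ∘ p-q≡0⇒p≡q

inv-inverseʳ : ∀ {p} → p ≢ 0ℚ → p * inv p ≡ 1ℚ
inv-inverseʳ {p} p≢0 with p ℚ.≟ 0ℚ
... | yes p≡0 = contradiction p≡0 p≢0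
... | no p≢0′ = *-inverseʳ p {{ℚ.≢-nonZero p≢0′}}

p*q≡r⇒q≡inv[p]*r : ∀ {p q r} → p ≢ 0ℚ → p * q ≡ r → q ≡ inv p * r
p*q≡r⇒q≡inv[p]*r {p} {q} {r} p≢0 p*q≡r = begin
  q                  ≡⟨ sym (*-identityˡ q) ⟩
  1ℚ * q             ≡⟨ cong (_* q) (sym (inv-inverseʳ p≢0)) ⟩
  (p * inv p) * q    ≡⟨ rearrange p (inv p) q ⟩
  inv p * (p * q)    ≡⟨ cong (inv p *_) p*q≡r ⟩
  inv p * r          ∎
  where
  rearrange : ∀ p p′ q → (p * p′) * q ≡ p′ * (p * q)
  rearrange = solve-∀ ℚ-ring

1≢0 : 1ℚ ≢ 0ℚ
1≢0 ()

p*q≡1⇒p≢0 : ∀ {p q} → p * q ≡ 1ℚ → p ≢ 0ℚ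
p*q≡1⇒p≢0 {p} {q} p*q≡1 p≡0 = 1≢0 (trans (sym p*q≡1) (trans (cong (_* q) p≡0) (*-zeroˡ q)))

p*q≡1⇒inv[p]≡q : ∀ {p q} → p * q ≡ 1ℚ → inv p ≡ q
p*q≡1⇒inv[p]≡q {p} {q} p*q≡1 =
  sym (trans (p*q≡r⇒q≡inv[p]*r {p} {q} (p*q≡1⇒p≢0 p*q≡1) p*q≡1) (*-identityʳ (inv p)))

∑-cong : ∀ {n} {f g : Fin n → ℚ} → (∀ i → f i ≡ g i) → ∑ f ≡ ∑ g
∑-cong {zero}  f≗g = refl
∑-cong {suc n} f≗g = cong₂ _+_ (f≗g zero) (∑-cong (f≗g ∘ suc))

∑-+ : ∀ {n} (f g : Fin n → ℚ) → ∑ (λ i → f i + g i) ≡ ∑ f + ∑ g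
∑-+ {zero}  f g = refl
∑-+ {suc n} f g =
  trans (cong (f zero + g zero +_) (∑-+ (f ∘ suc) (g ∘ suc)))
        (interchange (f zero) (g zero) (∑ (f ∘ suc)) (∑ (g ∘ suc)))
  where
  interchange : ∀ p q r s → (p + q) + (r + s) ≡ (p + r) + (q + s)
  interchange = solve-∀ ℚ-ring

∑-*ˡ : ∀ {n} (c : ℚ) (f : Fin n → ℚ) → ∑ (λ i → c * f i) ≡ c * ∑ f
∑-*ˡ {zero}  c f = sym (*-zeroʳ c)
∑-*ˡ {suc n} c f =
  trans (cong (c * f zero +_) (∑-*ˡ c (f ∘ suc))) (sym (*-distribˡ-+ c (f zero) (∑ (f ∘ suc))))

∑-*ʳ : ∀ {n} (f : Fin n → ℚ) (c : ℚ) → ∑ (λ i → f i * c) ≡ ∑ f * c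
∑-*ʳ {zero}  f c = sym (*-zeroˡ c)
∑-*ʳ {suc n} f c =
  trans (cong (f zero * c +_) (∑-*ʳ (f ∘ suc) c)) (sym (*-distribʳ-+ c (f zero) (∑ (f ∘ suc))))

∑-const : ∀ {n} (c : ℚ) → ∑ {n} (λ _ → c) ≡ ℕ→ℚ n * c
∑-const {zero}  c = sym (*-zeroˡ c)
∑-const {suc n} c = sym (begin
  ℕ→ℚ (suc n) * c        ≡⟨ cong (_* c) (ℕ→ℚ-suc n) ⟩
  (1ℚ + ℕ→ℚ n) * c       ≡⟨ *-distribʳ-+ c 1ℚ (ℕ→ℚ n) ⟩
  1ℚ * c + ℕ→ℚ n * c     ≡⟨ cong₂ _+_ (*-identityˡ c) (sym (∑-const {n} c)) ⟩
  c + ∑ {n} (λ _ → c)    ∎)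

∑-update : ∀ {n} (f g : Fin n → ℚ) (i : Fin n) → (∀ j → j ≢ i → f j ≡ g j) →
           ∑ f ≡ ∑ g + (f i - g i)
∑-update {suc n} f g zero f≗g =
  trans (cong (f zero +_) (∑-cong (λ j → f≗g (suc j) λ ())))
        (rearrange (f zero) (g zero) (∑ (g ∘ suc)))
  where
  rearrange : ∀ p q r → p + r ≡ (q + r) + (p - q)
  rearrange = solve-∀ ℚ-ring
∑-update {suc n} f g (suc i) f≗g =
  trans (cong₂ _+_ (f≗g zero λ ())
                   (∑-update (f ∘ suc) (g ∘ suc) i (λ j j≢i → f≗g (suc j) (j≢i ∘ suc-injective))))
        (sym (+-assoc (g zero) (∑ (g ∘ suc)) (f (suc i) - g (suc i))))

otherPart : ∀ {k} → k ≥ 2 → Fin k → Fin k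
otherPart (s≤s (s≤s _)) i = punchIn i zero

otherPart-≢ : ∀ {k} (k≥2 : k ≥ 2) i → otherPart k≥2 i ≢ i
otherPart-≢ (s≤s (s≤s _)) i = punchInᵢ≢i i zero

walk-length-0 : ∀ {k} {a : Fin k → ℕ} {u v} → Walk a u v 0 → u ≡ v
walk-length-0 nil = refl

walk-length-1 : ∀ {k} {a : Fin k → ℕ} {u v} → Walk a u v 1 → Adj a u v
walk-length-1 (cons u~v nil) = u~v

shortestWalk⇒distance : ∀ {k} {a : Fin k → ℕ} {D u v n} → IsDistance a D →
                        Walk a u v n → (∀ {m} → m < n → ¬ Walk a u v m) → D u v ≡ n
shortestWalk⇒distance {u = u} {v} isD walk noShorter =
  ℕₚ.≤-antisym (proj₂ (isD u v) _ walk) (ℕₚ.≮⇒≥ (λ D<n → noShorter D<n (proj₁ (isD u v))))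

module CompleteMultipartite {k} (k≥2 : k ≥ 2) (a : Fin k → ℕ) (a≥1 : ∀ i → 1 ≤ a i)
                            (D : Vertex a → Vertex a → ℕ) (isD : IsDistance a D) where

  distance-self : ∀ u → D u u ≡ 0
  distance-self u = shortestWalk⇒distance isD nil λ ()

  distance-otherPart : ∀ {i i′ j j′} → i ≢ i′ → D (i , j) (i′ , j′) ≡ 1
  distance-otherPart i≢i′ = shortestWalk⇒distance isD (cons i≢i′ nil) λ where
    (s≤s z≤n) walk → i≢i′ (cong proj₁ (walk-length-0 walk))

  distance-samePart : ∀ {i j j′} → j ≢ j′ → D (i , j) (i , j′) ≡ 2
  distance-samePart {i} {j} {j′} j≢j′ = shortestWalk⇒distance isD viaOtherPart noShorter
    where
    i′ = otherPart k≥2 i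

    viaOtherPart : Walk a (i , j) (i , j′) 2
    viaOtherPart = cons {w = i′ , fromℕ< (a≥1 i′)} (≢-sym (otherPart-≢ k≥2 i)) (cons (otherPart-≢ k≥2 i) nil)

    sameVertex : (Vertex a ∋ (i , j)) ≡ (i , j′) → j ≡ j′
    sameVertex refl = refl

    noShorter : ∀ {m} → m < 2 → ¬ Walk a (i , j) (i , j′) m
    noShorter (s≤s z≤n)       walk = j≢j′ (sameVertex (walk-length-0 walk))
    noShorter (s≤s (s≤s z≤n)) walk = walk-length-1 walk refl

  aℚ : Fin k → ℚ
  aℚ i = ℕ→ℚ (a i)

  partSum : (Vertex a → ℚ) → Fin k → ℚ
  partSum x i = ∑ (λ j → x (i , j))

  D·x≡∑V+partSum-2x : ∀ x i j → (D · x) (i , j) ≡ ∑V a x + partSum x i - ℕ→ℚ 2 * x (i , j)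
  D·x≡∑V+partSum-2x x i j = begin
    (D · x) (i , j)
      ≡⟨ ∑-update row (partSum x) i (λ i′ i′≢i → ∑-cong (otherPartEntry i′≢i)) ⟩
    ∑V a x + (row i - partSum x i)
      ≡⟨ cong (λ r → ∑V a x + (r - partSum x i)) ownPart ⟩
    ∑V a x + ((ℕ→ℚ 2 * partSum x i + (ℕ→ℚ 0 * x (i , j) - ℕ→ℚ 2 * x (i , j))) - partSum x i)
      ≡⟨ rearrange (∑V a x) (partSum x i) (x (i , j)) ⟩
    ∑V a x + partSum x i - ℕ→ℚ 2 * x (i , j)
      ∎
    where
    row : Fin k → ℚ
    row i′ = ∑ (λ j′ → ℕ→ℚ (D (i , j) (i′ , j′)) * x (i′ , j′))

    otherPartEntry : ∀ {i′} → i′ ≢ i → ∀ j′ → ℕ→ℚ (D (i , j) (i′ , j′)) * x (i′ , j′) ≡ x (i′ , j′)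
    otherPartEntry {i′} i′≢i j′ =
      trans (cong (λ d → ℕ→ℚ d * x (i′ , j′)) (distance-otherPart (≢-sym i′≢i))) (*-identityˡ (x (i′ , j′)))

    ownPart : row i ≡ ℕ→ℚ 2 * partSum x i + (ℕ→ℚ 0 * x (i , j) - ℕ→ℚ 2 * x (i , j))
    ownPart = begin
      row i
        ≡⟨ ∑-update _ (λ j′ → ℕ→ℚ 2 * x (i , j′)) j
             (λ j′ j′≢j → cong (λ d → ℕ→ℚ d * x (i , j′)) (distance-samePart (≢-sym j′≢j))) ⟩
      ∑ (λ j′ → ℕ→ℚ 2 * x (i , j′)) + (ℕ→ℚ (D (i , j) (i , j)) * x (i , j) - ℕ→ℚ 2 * x (i , j))
        ≡⟨ cong₂ (λ s d → s + (ℕ→ℚ d * x (i , j) - ℕ→ℚ 2 * x (i , j)))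
                 (∑-*ˡ (ℕ→ℚ 2) (λ j′ → x (i , j′))) (distance-self (i , j)) ⟩
      ℕ→ℚ 2 * partSum x i + (ℕ→ℚ 0 * x (i , j) - ℕ→ℚ 2 * x (i , j))
        ∎

    rearrange : ∀ T P y → T + ((ℕ→ℚ 2 * P + (ℕ→ℚ 0 * y - ℕ→ℚ 2 * y)) - P) ≡ T + P - ℕ→ℚ 2 * y
    rearrange = solve-∀ ℚ-ring

  partSum-balance : ∀ x t i → (∀ j → (D · x) (i , j) ≡ t) →
                    (aℚ i - ℕ→ℚ 2) * partSum x i ≡ aℚ i * (t - ∑V a x)
  partSum-balance x t i D·x≡t = begin
    (aℚ i - ℕ→ℚ 2) * P                             ≡⟨ expand (aℚ i) T P ⟩
    (aℚ i * (T + P) + (- ℕ→ℚ 2) * P) - aℚ i * T    ≡⟨ cong (_- aℚ i * T) partTotal ⟩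
    aℚ i * t - aℚ i * T                            ≡⟨ factor (aℚ i) t T ⟩
    aℚ i * (t - T)                                 ∎
    where
    T = ∑V a x
    P = partSum x i

    regroup : ∀ T P y → T + P + (- ℕ→ℚ 2) * y ≡ T + P - ℕ→ℚ 2 * y
    regroup = solve-∀ ℚ-ring

    partTotal : aℚ i * (T + P) + (- ℕ→ℚ 2) * P ≡ aℚ i * t
    partTotal = begin
      aℚ i * (T + P) + (- ℕ→ℚ 2) * P
        ≡⟨ cong₂ _+_ (sym (∑-const {a i} (T + P))) (sym (∑-*ˡ (- ℕ→ℚ 2) (λ j → x (i , j)))) ⟩
      ∑ {a i} (λ _ → T + P) + ∑ (λ j → (- ℕ→ℚ 2) * x (i , j))
        ≡⟨ sym (∑-+ (λ _ → T + P) (λ j → (- ℕ→ℚ 2) * x (i , j))) ⟩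
      ∑ (λ j → T + P + (- ℕ→ℚ 2) * x (i , j))
        ≡⟨ ∑-cong (λ j → trans (regroup T P (x (i , j))) (sym (D·x≡∑V+partSum-2x x i j))) ⟩
      ∑ (λ j → (D · x) (i , j))
        ≡⟨ ∑-cong D·x≡t ⟩
      ∑ {a i} (λ _ → t)
        ≡⟨ ∑-const {a i} t ⟩
      aℚ i * t
        ∎

    expand : ∀ A T P → (A - ℕ→ℚ 2) * P ≡ (A * (T + P) + (- ℕ→ℚ 2) * P) - A * T
    expand = solve-∀ ℚ-ring

    factor : ∀ A t T → A * t - A * T ≡ A * (t - T)
    factor = solve-∀ ℚ-ring

  ∑V≡S*[t-∑V] : (∀ i → a i ≢ 2) → ∀ x t → (∀ u → (D · x) u ≡ t) → ∑V a x ≡ S a * (t - ∑V a x)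
  ∑V≡S*[t-∑V] a≢2 x t D·x≡t = begin
    ∑ (partSum x)
      ≡⟨ ∑-cong partSum≡ ⟩
    ∑ (λ i → aℚ i * inv (aℚ i - ℕ→ℚ 2) * (t - ∑V a x))
      ≡⟨ ∑-*ʳ (λ i → aℚ i * inv (aℚ i - ℕ→ℚ 2)) (t - ∑V a x) ⟩
    S a * (t - ∑V a x)
      ∎
    where
    rearrange : ∀ p q r → q * (p * r) ≡ p * q * r
    rearrange = solve-∀ ℚ-ring

    partSum≡ : ∀ i → partSum x i ≡ aℚ i * inv (aℚ i - ℕ→ℚ 2) * (t - ∑V a x)
    partSum≡ i =
      trans (p*q≡r⇒q≡inv[p]*r (ℕ→ℚ-difference≢0 (a≢2 i)) (partSum-balance x t i (λ j → D·x≡t (i , j))))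
            (rearrange (aℚ i) (inv (aℚ i - ℕ→ℚ 2)) (t - ∑V a x))

  size2⇒t≡∑V : ∀ x t i → a i ≡ 2 → (∀ j → (D · x) (i , j) ≡ t) → t ≡ ∑V a x
  size2⇒t≡∑V x t i aᵢ≡2 D·x≡t =
    p-q≡0⇒p≡q (trans (p*q≡r⇒q≡inv[p]*r {ℕ→ℚ 2} (λ ()) 2*gap≡0) (*-zeroʳ (inv (ℕ→ℚ 2))))
    where
    2*gap≡0 : ℕ→ℚ 2 * (t - ∑V a x) ≡ 0ℚ
    2*gap≡0 = begin
      ℕ→ℚ 2 * (t - ∑V a x)             ≡⟨ cong (λ n → ℕ→ℚ n * (t - ∑V a x)) (sym aᵢ≡2) ⟩
      aℚ i * (t - ∑V a x)              ≡⟨ sym (partSum-balance x t i D·x≡t) ⟩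
      (aℚ i - ℕ→ℚ 2) * partSum x i     ≡⟨ cong (λ n → (ℕ→ℚ n - ℕ→ℚ 2) * partSum x i) aᵢ≡2 ⟩
      (ℕ→ℚ 2 - ℕ→ℚ 2) * partSum x i    ≡⟨ *-zeroˡ (partSum x i) ⟩
      0ℚ                               ∎

  partwise : (Fin k → ℚ) → Vertex a → ℚ
  partwise c (i , _) = c i

  ∑V-partwise : ∀ c → ∑V a (partwise c) ≡ ∑ (λ i → aℚ i * c i)
  ∑V-partwise c = ∑-cong (λ i → ∑-const {a i} (c i))

  D·partwise : ∀ c i j → (D · partwise c) (i , j) ≡ ∑ (λ i → aℚ i * c i) + (aℚ i - ℕ→ℚ 2) * c i
  D·partwise c i j = begin
    (D · partwise c) (i , j)
      ≡⟨ D·x≡∑V+partSum-2x (partwise c) i j ⟩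
    ∑V a (partwise c) + partSum (partwise c) i - ℕ→ℚ 2 * c i
      ≡⟨ cong₂ (λ T P → T + P - ℕ→ℚ 2 * c i) (∑V-partwise c) (∑-const {a i} (c i)) ⟩
    ∑ (λ i → aℚ i * c i) + aℚ i * c i - ℕ→ℚ 2 * c i
      ≡⟨ factor (∑ (λ i → aℚ i * c i)) (aℚ i) (c i) ⟩
    ∑ (λ i → aℚ i * c i) + (aℚ i - ℕ→ℚ 2) * c i
      ∎
    where
    factor : ∀ T p q → T + p * q - ℕ→ℚ 2 * q ≡ T + (p - ℕ→ℚ 2) * q
    factor = solve-∀ ℚ-ring

  partwiseInverse : ℚ → Vertex a → ℚ
  partwiseInverse u = partwise (λ i → inv (aℚ i - ℕ→ℚ 2) * u)

  weight-partwiseInverse : ∀ u → ∑ (λ i → aℚ i * (inv (aℚ i - ℕ→ℚ 2) * u)) ≡ S a * u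
  weight-partwiseInverse u =
    trans (∑-cong (λ i → sym (*-assoc (aℚ i) (inv (aℚ i - ℕ→ℚ 2)) u)))
          (∑-*ʳ (λ i → aℚ i * inv (aℚ i - ℕ→ℚ 2)) u)

  ∑V-partwiseInverse : ∀ u → ∑V a (partwiseInverse u) ≡ S a * u
  ∑V-partwiseInverse u = trans (∑V-partwise (λ i → inv (aℚ i - ℕ→ℚ 2) * u)) (weight-partwiseInverse u)

  D·partwiseInverse : (∀ i → a i ≢ 2) → ∀ u v → (D · partwiseInverse u) v ≡ S a * u + u
  D·partwiseInverse a≢2 u (i , j) =
    trans (D·partwise _ i j) (cong₂ _+_ (weight-partwiseInverse u) cancel)
    where
    cancel : (aℚ i - ℕ→ℚ 2) * (inv (aℚ i - ℕ→ℚ 2) * u) ≡ u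
    cancel = begin
      (aℚ i - ℕ→ℚ 2) * (inv (aℚ i - ℕ→ℚ 2) * u)  ≡⟨ sym (*-assoc (aℚ i - ℕ→ℚ 2) (inv (aℚ i - ℕ→ℚ 2)) u) ⟩
      (aℚ i - ℕ→ℚ 2) * inv (aℚ i - ℕ→ℚ 2) * u    ≡⟨ cong (_* u) (inv-inverseʳ (ℕ→ℚ-difference≢0 (a≢2 i))) ⟩
      1ℚ * u                                     ≡⟨ *-identityˡ u ⟩
      u                                          ∎

  [S+1]*∑V≡S : (∀ i → a i ≢ 2) → ∀ {x} → IsPotential a D x → (S a + 1ℚ) * ∑V a x ≡ S a
  [S+1]*∑V≡S a≢2 {x} potential = begin
    (S a + 1ℚ) * ∑V a x                   ≡⟨ distribute (S a) (∑V a x) ⟩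
    S a * ∑V a x + ∑V a x                 ≡⟨ cong (S a * ∑V a x +_) (∑V≡S*[t-∑V] a≢2 x 1ℚ potential) ⟩
    S a * ∑V a x + S a * (1ℚ - ∑V a x)    ≡⟨ collect (S a) (∑V a x) ⟩
    S a                                   ∎
    where
    distribute : ∀ s t → (s + 1ℚ) * t ≡ s * t + t
    distribute = solve-∀ ℚ-ring

    collect : ∀ s t → s * t + s * (1ℚ - t) ≡ s
    collect = solve-∀ ℚ-ring

  ι≡1+1/S : (∀ i → a i ≢ 2) → S a ≢ 0ℚ → CurvatureIndexIs a D (fin (1ℚ + inv (S a)))
  ι≡1+1/S a≢2 S≢0 = finite , inX , unique
    where
    [S+1]*∑V≢0 : ∀ {x} → IsPotential a D x → (S a + 1ℚ) * ∑V a x ≢ 0ℚ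
    [S+1]*∑V≢0 potential = S≢0 ∘ trans (sym ([S+1]*∑V≡S a≢2 potential))

    finite : FiniteCase a D
    finite with S a + 1ℚ ℚ.≟ 0ℚ
    ... | yes S+1≡0 = inj₁ λ (x , potential) →
      [S+1]*∑V≢0 potential (trans (cong (_* ∑V a x) S+1≡0) (*-zeroˡ (∑V a x)))
    ... | no S+1≢0 = inj₂ (x , potential , λ ∑V≡0 →
      [S+1]*∑V≢0 potential (trans (cong ((S a + 1ℚ) *_) ∑V≡0) (*-zeroʳ (S a + 1ℚ))))
      where
      u = inv (S a + 1ℚ)
      x = partwiseInverse u
      potential : IsPotential a D x
      potential v = begin
        (D · x) v          ≡⟨ D·partwiseInverse a≢2 u v ⟩
        S a * u + u        ≡⟨ cong (S a * u +_) (sym (*-identityˡ u)) ⟩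
        S a * u + 1ℚ * u   ≡⟨ sym (*-distribʳ-+ u (S a) 1ℚ) ⟩
        (S a + 1ℚ) * u     ≡⟨ inv-inverseʳ S+1≢0 ⟩
        1ℚ                 ∎

    inX : InX a D (λ _ → 1ℚ + inv (S a))
    inX = partwiseInverse (inv (S a))
        , trans (∑V-partwiseInverse (inv (S a))) (inv-inverseʳ S≢0)
        , λ v → trans (D·partwiseInverse a≢2 (inv (S a)) v) (cong (_+ inv (S a)) (inv-inverseʳ S≢0))

    unique : ∀ s → InX a D (λ _ → s) → s ≡ 1ℚ + inv (S a)
    unique s (x , ∑V≡1 , D·x≡s) = begin
      s                   ≡⟨ split s ⟩
      1ℚ + (s - 1ℚ)       ≡⟨ cong (1ℚ +_) (p*q≡r⇒q≡inv[p]*r S≢0 S*[s-1]≡1) ⟩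
      1ℚ + inv (S a) * 1ℚ ≡⟨ cong (1ℚ +_) (*-identityʳ (inv (S a))) ⟩
      1ℚ + inv (S a)      ∎
      where
      split : ∀ s → s ≡ 1ℚ + (s - 1ℚ)
      split = solve-∀ ℚ-ring

      S*[s-1]≡1 : S a * (s - 1ℚ) ≡ 1ℚ
      S*[s-1]≡1 = begin
        S a * (s - 1ℚ)        ≡⟨ cong (λ T → S a * (s - T)) (sym ∑V≡1) ⟩
        S a * (s - ∑V a x)    ≡⟨ sym (∑V≡S*[t-∑V] a≢2 x s D·x≡s) ⟩
        ∑V a x                ≡⟨ ∑V≡1 ⟩
        1ℚ                    ∎

  ι≡∞ : (∀ i → a i ≢ 2) → S a ≡ 0ℚ → CurvatureIndexIs a D ∞
  ι≡∞ a≢2 S≡0 (inj₁ exceptional) = exceptional (partwiseInverse 1ℚ , potential)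
    where
    potential : IsPotential a D (partwiseInverse 1ℚ)
    potential v = trans (D·partwiseInverse a≢2 1ℚ v) (cong (λ s → s * 1ℚ + 1ℚ) S≡0)
  ι≡∞ a≢2 S≡0 (inj₂ (x , potential , ∑V≢0)) = ∑V≢0 (begin
    ∑V a x                 ≡⟨ sym (*-identityˡ (∑V a x)) ⟩
    (0ℚ + 1ℚ) * ∑V a x     ≡⟨ cong (λ s → (s + 1ℚ) * ∑V a x) (sym S≡0) ⟩
    (S a + 1ℚ) * ∑V a x    ≡⟨ [S+1]*∑V≡S a≢2 potential ⟩
    S a                    ≡⟨ S≡0 ⟩
    0ℚ                     ∎)

  ι≡1 : (∃ λ i → a i ≡ 2) → CurvatureIndexIs a D (fin 1ℚ)
  ι≡1 (i₀ , a₀≡2) =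
      inj₂ (x , potential , λ ∑V≡0 → 1≢0 (trans (sym ∑V≡1) ∑V≡0))
    , (x , ∑V≡1 , potential)
    , λ s (y , ∑V≡1′ , D·y≡s) → trans (size2⇒t≡∑V y s i₀ a₀≡2 (λ j → D·y≡s (i₀ , j))) ∑V≡1′
    where
    c : Fin k → ℚ
    c = updateAt (λ _ → 0ℚ) i₀ (λ _ → ½)

    c-off : ∀ i → i ≢ i₀ → c i ≡ 0ℚ
    c-off i i≢i₀ = updateAt-minimal i i₀ (λ _ → 0ℚ) i≢i₀

    x = partwise c

    weight : ∑ (λ i → aℚ i * c i) ≡ 1ℚ
    weight = begin
      ∑ (λ i → aℚ i * c i)
        ≡⟨ ∑-update _ (λ _ → 0ℚ) i₀ (λ i i≢i₀ → trans (cong (aℚ i *_) (c-off i i≢i₀)) (*-zeroʳ (aℚ i))) ⟩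
      ∑ {k} (λ _ → 0ℚ) + (aℚ i₀ * c i₀ - 0ℚ)
        ≡⟨ cong₂ (λ z n → z + (ℕ→ℚ n * c i₀ - 0ℚ)) (trans (∑-const {k} 0ℚ) (*-zeroʳ (ℕ→ℚ k))) a₀≡2 ⟩
      0ℚ + (ℕ→ℚ 2 * c i₀ - 0ℚ)
        ≡⟨ cong (λ z → 0ℚ + (ℕ→ℚ 2 * z - 0ℚ)) (updateAt-updates i₀ (λ _ → 0ℚ)) ⟩
      1ℚ
        ∎

    ∑V≡1 : ∑V a x ≡ 1ℚ
    ∑V≡1 = trans (∑V-partwise c) weight

    vanishes : ∀ i → (aℚ i - ℕ→ℚ 2) * c i ≡ 0ℚ
    vanishes i with i Fin.≟ i₀
    ... | yes refl = trans (cong (λ n → (ℕ→ℚ n - ℕ→ℚ 2) * c i₀) a₀≡2) (*-zeroˡ (c i₀))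
    ... | no i≢i₀  = trans (cong ((aℚ i - ℕ→ℚ 2) *_) (c-off i i≢i₀)) (*-zeroʳ (aℚ i - ℕ→ℚ 2))

    potential : IsPotential a D x
    potential (i , j) = trans (D·partwise c i j) (cong₂ _+_ weight (vanishes i))

S[a11]*[2-m]/[m-4]≡1 : ∀ {m} → m ≢ 2 → m ≢ 4 →
                       S (a11 m) * - ((ℕ→ℚ m - ℕ→ℚ 2) * inv (ℕ→ℚ m - ℕ→ℚ 4)) ≡ 1ℚ
S[a11]*[2-m]/[m-4]≡1 {m} m≢2 m≢4 = begin
  S (a11 m) * - ((M - ℕ→ℚ 2) * inv (M - ℕ→ℚ 4))
    ≡⟨ expand M (inv (M - ℕ→ℚ 2)) (inv (M - ℕ→ℚ 4)) ⟩
  (ℕ→ℚ 2 * (M - ℕ→ℚ 2) - M * ((M - ℕ→ℚ 2) * inv (M - ℕ→ℚ 2))) * inv (M - ℕ→ℚ 4)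
    ≡⟨ cong (λ r → (ℕ→ℚ 2 * (M - ℕ→ℚ 2) - M * r) * inv (M - ℕ→ℚ 4))
            (inv-inverseʳ (ℕ→ℚ-difference≢0 m≢2)) ⟩
  (ℕ→ℚ 2 * (M - ℕ→ℚ 2) - M * 1ℚ) * inv (M - ℕ→ℚ 4)
    ≡⟨ simplify M (inv (M - ℕ→ℚ 4)) ⟩
  (M - ℕ→ℚ 4) * inv (M - ℕ→ℚ 4)
    ≡⟨ inv-inverseʳ (ℕ→ℚ-difference≢0 m≢4) ⟩
  1ℚ
    ∎
  where
  M = ℕ→ℚ m

  -- the two parts of size 1 contribute 1 / (1 - 2) = -1 each to S (a11 m)
  expand : ∀ M p q → (- 1ℚ + (- 1ℚ + (M * p + 0ℚ))) * - ((M - ℕ→ℚ 2) * q)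
                     ≡ (ℕ→ℚ 2 * (M - ℕ→ℚ 2) - M * ((M - ℕ→ℚ 2) * p)) * q
  expand = solve-∀ ℚ-ring

  simplify : ∀ M q → (ℕ→ℚ 2 * (M - ℕ→ℚ 2) - M * 1ℚ) * q ≡ (M - ℕ→ℚ 4) * q
  simplify = solve-∀ ℚ-ring

1+inv[S[a11]]≡-2/[m-4] : ∀ {m} → m ≢ 2 → m ≢ 4 →
                         1ℚ + inv (S (a11 m)) ≡ - (ℕ→ℚ 2 * inv (ℕ→ℚ m - ℕ→ℚ 4))
1+inv[S[a11]]≡-2/[m-4] {m} m≢2 m≢4 = begin
  1ℚ + inv (S (a11 m))
    ≡⟨ cong₂ _+_ (sym (inv-inverseʳ (ℕ→ℚ-difference≢0 m≢4)))
                 (p*q≡1⇒inv[p]≡q {S (a11 m)} (S[a11]*[2-m]/[m-4]≡1 m≢2 m≢4)) ⟩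
  (M - ℕ→ℚ 4) * inv (M - ℕ→ℚ 4) + - ((M - ℕ→ℚ 2) * inv (M - ℕ→ℚ 4))
    ≡⟨ collect M (inv (M - ℕ→ℚ 4)) ⟩
  - (ℕ→ℚ 2 * inv (M - ℕ→ℚ 4))
    ∎
  where
  M = ℕ→ℚ m

  collect : ∀ M q → (M - ℕ→ℚ 4) * q + - ((M - ℕ→ℚ 2) * q) ≡ - (ℕ→ℚ 2 * q)
  collect = solve-∀ ℚ-ring

ι[K₁₁ₘ]≡-2/[m-4] : ∀ m → 1 ≤ m → m ≢ 2 → m ≢ 4 →
                   (D : Vertex (a11 m) → Vertex (a11 m) → ℕ) → IsDistance (a11 m) D →
                   CurvatureIndexIs (a11 m) D (fin (- (ℕ→ℚ 2 * inv (ℕ→ℚ m - ℕ→ℚ 4))))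
ι[K₁₁ₘ]≡-2/[m-4] m m≥1 m≢2 m≢4 D isD =
  subst (CurvatureIndexIs (a11 m) D ∘ fin) (1+inv[S[a11]]≡-2/[m-4] m≢2 m≢4)
        (CompleteMultipartite.ι≡1+1/S (s≤s (s≤s z≤n)) (a11 m) sizes≥1 D isD sizes≢2
          (p*q≡1⇒p≢0 (S[a11]*[2-m]/[m-4]≡1 m≢2 m≢4)))
  where
  sizes≥1 : ∀ i → 1 ≤ a11 m i
  sizes≥1 zero             = s≤s z≤n
  sizes≥1 (suc zero)       = s≤s z≤n
  sizes≥1 (suc (suc zero)) = m≥1

  sizes≢2 : ∀ i → a11 m i ≢ 2
  sizes≢2 zero             = λ ()
  sizes≢2 (suc zero)       = λ ()
  sizes≢2 (suc (suc zero)) = m≢2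

theorem4p3 :
    ((k : ℕ) → k ≥ 2 → (a : Fin k → ℕ) → (∀ i → 1 ≤ a i) →
      (D : Vertex a → Vertex a → ℕ) → IsDistance a D →
        ((∀ i → a i ≢ 2) → S a ≢ 0ℚ → CurvatureIndexIs a D (fin (1ℚ + inv (S a))))
        × ((∀ i → a i ≢ 2) → S a ≡ 0ℚ → CurvatureIndexIs a D ∞)
        × ((∃ λ i → a i ≡ 2) → CurvatureIndexIs a D (fin 1ℚ)))
    × ((m : ℕ) → m ≥ 5 → (D : Vertex (a11 m) → Vertex (a11 m) → ℕ) → IsDistance (a11 m) D →
        CurvatureIndexIs (a11 m) D (fin (- (ℕ→ℚ 2 * inv (ℕ→ℚ m - ℕ→ℚ 4)))))
theorem4p3 =
    (λ k k≥2 a a≥1 D isD → let open CompleteMultipartite k≥2 a a≥1 D isD in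
      ι≡1+1/S , ι≡∞ , ι≡1)
  , (λ m m≥5 → ι[K₁₁ₘ]≡-2/[m-4] m (ℕₚ.≤-trans (s≤s z≤n) m≥5)
                                 (ℕₚ.>⇒≢ (ℕₚ.≤-trans (s≤s (s≤s (s≤s z≤n))) m≥5))
                                 (ℕₚ.>⇒≢ m≥5))
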